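{- For every integer $k \geq 1$, the map $\Phi_k: \{0,1,\ldots,2^k-1\} \to \{0,1,\ldots,2^k-1\}$ defined by $\Phi_k(n) = \sum_{i=0}^{k-1} x_i(n)\, 2^i$ is a (directed) graph isomorphism from the binary Collatz graph $C(k)$ to the binary De Bruijn graph $B(2,k)$.
   Context: Let $T:\mathbb{Z}\to\mathbb{Z}$ be the $3n+1$ function: $T(n) = (3n+1)/2$ if $n$ is odd and $T(n) = n/2$ if $n$ is even; $T^0(n)=n$, $T^{j+1}(n)=T(T^j(n))$. For an integer $n$ and $i \geq 0$, let $x_i(n) \in \{0,1\}$ be defined by $x_i(n) \equiv T^i(n) \pmod 2$. (For $i<k$, $x_i(n)$ depends only on $n \bmod 2^k$.) All graphs are directed. For a modulus $m$, the modular Collatz graph with modulus $m$ has vertex set $\{0,1,\ldots,m-1\}$ and a directed edge from $a$ to $b$ if and only if there exist integers $a_1 \equiv a \pmod m$ and $b_1 \equiv b \pmod m$ with $T(a_1)=b_1$. The binary Collatz graph $C(k)$ is the modular Collatz graph with modulus $2^k$. The binary De Bruijn graph $B(2,k)$ has vertex set $\{0,1,\ldots,2^k-1\}$, where a number $\sum_{i=0}^{k-1} b_i 2^i$ ($b_i\in\{0,1\}$) is identified with the word $b_0b_1\cdots b_{k-1}$, and there is an edge from the word $a_0a_1\cdots a_{k-1}$ to the word $b_0b_1\cdots b_{k-1}$ if and only if $a_{i+1}=b_i$ for $i=0,\ldots,k-2$. -}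

module Defs where

open import Data.Nat as ℕ using (ℕ; zero; suc; _^_; _<_)
open import Data.Nat.DivMod using () renaming (_/_ to _/ⁿ_; _%_ to _%ⁿ_)
open import Data.Integer as ℤ using (ℤ; +_; _-_)
open import Data.Integer.DivMod using (_/ℕ_; _%ℕ_)
open import Data.Integer.Divisibility using (_∣_)
open import Data.Product using (Σ; _×_)
open import Relation.Binary.PropositionalEquality using (_≡_)

T : ℤ → ℤ
T n with n %ℕ 2
... | zero  = n /ℕ 2
... | suc _ = ((+ 3) ℤ.* n ℤ.+ (+ 1)) /ℕ 2

T^ : ℕ → ℤ → ℤ
T^ zero    n = n
T^ (suc j) n = T (T^ j n)

x : ℕ → ℤ → ℕ
x i n = T^ i n %ℕ 2

sumTo : ℕ → (ℕ → ℕ) → ℕ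
sumTo zero    f = 0
sumTo (suc k) f = sumTo k f ℕ.+ f k

Φ : ℕ → ℕ → ℕ
Φ k n = sumTo k (λ i → x i (+ n) ℕ.* (2 ^ i))

ModCollatzEdge : ℕ → ℕ → ℕ → Set
ModCollatzEdge m a b =
  Σ ℤ λ a₁ → Σ ℤ λ b₁ →
    ((+ m) ∣ (a₁ - + a)) × ((+ m) ∣ (b₁ - + b)) × (T a₁ ≡ b₁)

CEdge : ℕ → ℕ → ℕ → Set
CEdge k = ModCollatzEdge (2 ^ k)

bit : ℕ → ℕ → ℕ
bit a zero    = a %ⁿ 2
bit a (suc i) = bit (a /ⁿ 2) i

BEdge : ℕ → ℕ → ℕ → Set
BEdge k a b = (i : ℕ) → suc i < k → bit a (suc i) ≡ bit b i

IsGraphIso : (N : ℕ) → (ℕ → ℕ → Set) → (ℕ → ℕ → Set) → (ℕ → ℕ) → Set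
IsGraphIso N E₁ E₂ f =
  ((a : ℕ) → a < N → f a < N) ×
  ((a b : ℕ) → a < N → b < N → f a ≡ f b → a ≡ b) ×
  ((c : ℕ) → c < N → Σ ℕ λ a → (a < N) × (f a ≡ c)) ×
  ((a b : ℕ) → a < N → b < N →
     (E₁ a b → E₂ (f a) (f b)) × (E₂ (f a) (f b) → E₁ a b))

module Submission where

-- The key fact is a shift lemma for the 3n+1 map: adding c·2^i to n adds
-- c times an odd number to T^i(n) (T^-+).  Consequently the parities
-- x_0(n), …, x_{k-1}(n) depend only on n mod 2^k (x-periodic), while adding
-- 2^k flips x_k(n) (x-flip).  Together these show that the parity vector of
-- length k determines n mod 2^k (parities⇒congruent) and that every vector of
-- k parities occurs for some residue below 2^k (realise).
--
-- Since
-- Φ_k(n) has binary digits x_i(n), Φ_k is injective and surjective on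
-- {0,…,2^k-1}.  Finally, since x_i(T n) = x_{i+1}(n), both an edge a → b of
-- C(k) and an edge Φ_k(a) → Φ_k(b) of B(2,k) are equivalent to
-- x_{i+1}(a) = x_i(b) for i + 1 < k (ShiftedParities), which gives the
-- edge correspondence.

open import Defs
open import Data.Nat using (ℕ; _≥_; _^_)

module Binary where
  open import Data.Nat using (zero; suc; _+_; _*_; _<_; _≤_; z≤n; s≤s)
  open import Data.Nat.Properties
  open import Data.Nat.DivMod
  open import Data.Nat.Divisibility using (n∣m*n)
  open import Algebra.Properties.CommutativeSemigroup *-commutativeSemigroup
    using (x∙yz≈y∙xz)
  open import Function using (_∘_)
  open import Relation.Binary.PropositionalEquality

  Digits : (ℕ → ℕ) → Set
  Digits d = ∀ i → d i ≤ 1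

  value : ℕ → (ℕ → ℕ) → ℕ
  value k d = sumTo k (λ i → d i * 2 ^ i)

  sumTo-cong : ∀ k {f g : ℕ → ℕ} → (∀ i → i < k → f i ≡ g i) → sumTo k f ≡ sumTo k g
  sumTo-cong zero    f≗g = refl
  sumTo-cong (suc k) f≗g =
    cong₂ _+_ (sumTo-cong k (λ i i<k → f≗g i (m≤n⇒m≤1+n i<k))) (f≗g k ≤-refl)

  sumTo-head : ∀ k (f : ℕ → ℕ) → sumTo (suc k) f ≡ f 0 + sumTo k (f ∘ suc)
  sumTo-head zero    f = +-comm 0 (f 0)
  sumTo-head (suc k) f = trans (cong (_+ f (suc k)) (sumTo-head k f)) (+-assoc (f 0) _ _)

  sumTo-2* : ∀ k (f : ℕ → ℕ) → sumTo k (λ i → 2 * f i) ≡ 2 * sumTo k f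
  sumTo-2* zero    f = refl
  sumTo-2* (suc k) f =
    trans (cong (_+ 2 * f k) (sumTo-2* k f)) (sym (*-distribˡ-+ 2 (sumTo k f) (f k)))

  value-suc : ∀ k d → value (suc k) d ≡ d 0 + 2 * value k (d ∘ suc)
  value-suc k d = begin
    value (suc k) d                                      ≡⟨ sumTo-head k _ ⟩
    d 0 * 1 + sumTo k (λ i → d (suc i) * (2 * 2 ^ i))    ≡⟨ cong₂ _+_ (*-identityʳ (d 0))
                                                             (sumTo-cong k (λ i _ → x∙yz≈y∙xz (d (suc i)) 2 (2 ^ i))) ⟩
    d 0 + sumTo k (λ i → 2 * (d (suc i) * 2 ^ i))        ≡⟨ cong (d 0 +_) (sumTo-2* k _) ⟩
    d 0 + 2 * value k (d ∘ suc)                          ∎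
    where open ≡-Reasoning

  value-cong : ∀ k {d e : ℕ → ℕ} → (∀ i → i < k → d i ≡ e i) → value k d ≡ value k e
  value-cong k d≗e = sumTo-cong k (λ i i<k → cong (_* 2 ^ i) (d≗e i i<k))

  %2-digit : ∀ a S → a ≤ 1 → (a + 2 * S) % 2 ≡ a
  %2-digit a S a≤1 = begin
    (a + 2 * S) % 2 ≡⟨ cong (λ z → (a + z) % 2) (*-comm 2 S) ⟩
    (a + S * 2) % 2 ≡⟨ [m+kn]%n≡m%n a S 2 ⟩
    a % 2           ≡⟨ m<n⇒m%n≡m (s≤s a≤1) ⟩
    a               ∎
    where open ≡-Reasoning

  /2-digit : ∀ a S → a ≤ 1 → (a + 2 * S) / 2 ≡ S
  /2-digit a S a≤1 = begin
    (a + 2 * S) / 2   ≡⟨ cong (λ z → (a + z) / 2) (*-comm 2 S) ⟩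
    (a + S * 2) / 2   ≡⟨ +-distrib-/-∣ʳ a (n∣m*n S) ⟩
    a / 2 + S * 2 / 2 ≡⟨ cong₂ _+_ (m<n⇒m/n≡0 (s≤s a≤1)) (m*n/n≡m S 2) ⟩
    S                 ∎
    where open ≡-Reasoning

  bit-value : ∀ k d → Digits d → ∀ j → j < k → bit (value k d) j ≡ d j
  bit-value (suc k) d digits zero    _ =
    trans (cong (_% 2) (value-suc k d)) (%2-digit (d 0) (value k (d ∘ suc)) (digits 0))
  bit-value (suc k) d digits (suc j) (s≤s j<k) = begin
    bit (value (suc k) d / 2) j                 ≡⟨ cong (λ z → bit (z / 2) j) (value-suc k d) ⟩
    bit ((d 0 + 2 * value k (d ∘ suc)) / 2) j   ≡⟨ cong (λ z → bit z j) (/2-digit (d 0) (value k (d ∘ suc)) (digits 0)) ⟩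
    bit (value k (d ∘ suc)) j                   ≡⟨ bit-value k (d ∘ suc) (digits ∘ suc) j j<k ⟩
    d (suc j)                                   ∎
    where open ≡-Reasoning

  value< : ∀ k d → Digits d → value k d < 2 ^ k
  value< zero    d digits = s≤s z≤n
  value< (suc k) d digits = begin-strict
    value (suc k) d             ≡⟨ value-suc k d ⟩
    d 0 + 2 * V                 ≤⟨ +-monoˡ-≤ (2 * V) (digits 0) ⟩
    1 + 2 * V                   <⟨ n<1+n (1 + 2 * V) ⟩
    2 + 2 * V                   ≡⟨ *-distribˡ-+ 2 1 V ⟨
    2 * suc V                   ≤⟨ *-monoʳ-≤ 2 (value< k (d ∘ suc) (digits ∘ suc)) ⟩
    2 * 2 ^ k                   ∎
    where
    open ≤-Reasoning
    V : ℕ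
    V = value k (d ∘ suc)

  bit-digits : ∀ c → Digits (bit c)
  bit-digits c zero    = ≤-pred (m%n<n c 2)
  bit-digits c (suc i) = bit-digits (c / 2) i

  value-bit : ∀ k c → c < 2 ^ k → value k (bit c) ≡ c
  value-bit zero    zero    _ = refl
  value-bit zero    (suc c) (s≤s ())
  value-bit (suc k) c c<2^k+1 = begin
    value (suc k) (bit c)          ≡⟨ value-suc k (bit c) ⟩
    c % 2 + 2 * value k (bit (c / 2)) ≡⟨ cong (λ z → c % 2 + 2 * z) (value-bit k (c / 2) c/2<2^k) ⟩
    c % 2 + 2 * (c / 2)            ≡⟨ cong (c % 2 +_) (*-comm 2 (c / 2)) ⟩
    c % 2 + c / 2 * 2              ≡⟨ m≡m%n+[m/n]*n c 2 ⟨
    c                              ∎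
    where
    open ≡-Reasoning
    c/2<2^k : c / 2 < 2 ^ k
    c/2<2^k = m<n*o⇒m/o<n (subst (c <_) (*-comm 2 (2 ^ k)) c<2^k+1)

open Binary
open import Data.Nat as ℕ using (zero; suc; z≤n; s≤s)
import Data.Nat.Properties as ℕP
open import Data.Integer using (ℤ; +_; -[1+_]; _+_; _*_; -_; _-_; ∣_∣)
open import Data.Integer.DivMod using (_/ℕ_; _%ℕ_; n%ℕd<d; a≡a%ℕn+[a/ℕn]*n)
open import Data.Integer.Divisibility using (_∣_)
import Data.Integer.Divisibility.Signed as Signed
import Data.Integer.Properties as ℤP
open import Data.Integer.Tactic.RingSolver using (solve-∀)
open import Algebra.Properties.AbelianGroup ℤP.+-0-abelianGroup using () renaming (∙-cancelˡ to +-cancelˡ)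
open import Data.Product using (Σ; _×_; _,_; proj₁; proj₂)
open import Data.Sum using (_⊎_; inj₁; inj₂)
open import Data.Empty using (⊥-elim)
open import Relation.Nullary using (yes; no)
open import Relation.Binary.PropositionalEquality

two^ : ℕ → ℤ
two^ i = + (2 ^ i)

two^-suc : ∀ i → two^ (suc i) ≡ + 2 * two^ i
two^-suc i = ℤP.pos-* 2 (2 ^ i)

two^-+ : ∀ i j → two^ (i ℕ.+ j) ≡ two^ i * two^ j
two^-+ i j = trans (cong +_ (ℕP.^-distribˡ-+-* 2 i j)) (ℤP.pos-* (2 ^ i) (2 ^ j))

Odd : ℤ → Set
Odd o = Σ ℤ λ t → o ≡ + 1 + t * + 2

odd-* : ∀ {o o′} → Odd o → Odd o′ → Odd (o * o′)
odd-* (t , refl) (t′ , refl) = t + t′ + + 2 * t * t′ , product t t′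
  where
  product : ∀ t t′ → (+ 1 + t * + 2) * (+ 1 + t′ * + 2) ≡ + 1 + (t + t′ + + 2 * t * t′) * + 2
  product = solve-∀

odd≢even : ∀ q q′ → + 1 + q * + 2 ≢ q′ * + 2
odd≢even q q′ eq = 2≢1 (ℕP.m*n≡1⇒n≡1 ∣ q′ - q ∣ 2 (sym |1|≡))
  where
  2≢1 : 2 ≢ 1
  2≢1 ()
  rearrange : ∀ q q′ → q′ * + 2 - q * + 2 ≡ (q′ - q) * + 2
  rearrange = solve-∀
  cancel : ∀ q → (+ 1 + q * + 2) - q * + 2 ≡ + 1
  cancel = solve-∀
  1≡ : + 1 ≡ (q′ - q) * + 2
  1≡ = trans (sym (cancel q)) (trans (cong (_- q * + 2) eq) (rearrange q q′))
  |1|≡ : 1 ≡ ∣ q′ - q ∣ ℕ.* 2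
  |1|≡ = trans (cong ∣_∣ 1≡) (ℤP.abs-* (q′ - q) (+ 2))

halving-unique : ∀ r r′ q q′ → r ℕ.< 2 → r′ ℕ.< 2 →
                 + r + q * + 2 ≡ + r′ + q′ * + 2 → r ≡ r′ × q ≡ q′
halving-unique 0 0 q q′ _ _ eq =
  refl , ℤP.*-cancelʳ-≡ q q′ (+ 2) (trans (sym (ℤP.+-identityˡ _)) (trans eq (ℤP.+-identityˡ _)))
halving-unique 1 1 q q′ _ _ eq =
  refl , ℤP.*-cancelʳ-≡ q q′ (+ 2) (+-cancelˡ (+ 1) _ _ eq)
halving-unique 0 1 q q′ _ _ eq = ⊥-elim (odd≢even q′ q (sym (trans (sym (ℤP.+-identityˡ _)) eq)))
halving-unique 1 0 q q′ _ _ eq = ⊥-elim (odd≢even q q′ (trans eq (ℤP.+-identityˡ _)))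
halving-unique (suc (suc _)) _ _ _ (s≤s (s≤s ())) _ _
halving-unique _ (suc (suc _)) _ _ _ (s≤s (s≤s ())) _

%ℕ2-/ℕ2 : ∀ n r q → r ℕ.< 2 → n ≡ + r + q * + 2 → n %ℕ 2 ≡ r × n /ℕ 2 ≡ q
%ℕ2-/ℕ2 n r q r<2 eq =
  halving-unique (n %ℕ 2) r (n /ℕ 2) q (n%ℕd<d n 2) r<2 (trans (sym (a≡a%ℕn+[a/ℕn]*n n 2)) eq)

T-even : ∀ q → T (+ 0 + q * + 2) ≡ q
T-even q with (+ 0 + q * + 2) %ℕ 2 | %ℕ2-/ℕ2 (+ 0 + q * + 2) 0 q (s≤s z≤n) refl
... | .0 | refl , half = half

T-odd : ∀ q → T (+ 1 + q * + 2) ≡ + 2 + + 3 * q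
T-odd q with (+ 1 + q * + 2) %ℕ 2 | %ℕ2-/ℕ2 (+ 1 + q * + 2) 1 q (s≤s (s≤s z≤n)) refl
... | .1 | refl , _ = proj₂ (%ℕ2-/ℕ2 _ 0 (+ 2 + + 3 * q) (s≤s z≤n) (triple q))
  where
  triple : ∀ q → + 3 * (+ 1 + q * + 2) + + 1 ≡ + 0 + (+ 2 + + 3 * q) * + 2
  triple = solve-∀

even-or-odd : ∀ n → (n %ℕ 2 ≡ 0 × n ≡ + 0 + (n /ℕ 2) * + 2) ⊎ (n %ℕ 2 ≡ 1 × n ≡ + 1 + (n /ℕ 2) * + 2)
even-or-odd n with n %ℕ 2 | n%ℕd<d n 2 | a≡a%ℕn+[a/ℕn]*n n 2
... | 0           | _              | n≡ = inj₁ (refl , n≡)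
... | 1           | _              | n≡ = inj₂ (refl , n≡)
... | suc (suc _) | s≤s (s≤s ()) | _

regroup : ∀ r q v → r + q * + 2 + v * + 2 ≡ r + (q + v) * + 2
regroup = solve-∀

parity-+even : ∀ u v → (u + v * + 2) %ℕ 2 ≡ u %ℕ 2
parity-+even u v = proj₁ (%ℕ2-/ℕ2 _ (u %ℕ 2) (u /ℕ 2 + v) (n%ℕd<d u 2) u+2v≡)
  where
  u+2v≡ : u + v * + 2 ≡ + (u %ℕ 2) + (u /ℕ 2 + v) * + 2
  u+2v≡ = trans (cong (_+ v * + 2) (a≡a%ℕn+[a/ℕn]*n u 2)) (regroup (+ (u %ℕ 2)) (u /ℕ 2) v)

parity-+odd : ∀ u {w} → Odd w → (u + w) %ℕ 2 ≢ u %ℕ 2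
parity-+odd u (t , refl) with even-or-odd u
... | inj₁ (u%2≡0 , u≡) = λ same → 1≢0 (trans (sym sum-odd) (trans same u%2≡0))
  where
  1≢0 : 1 ≢ 0
  1≢0 ()
  regroup-odd : ∀ q t → (+ 0 + q * + 2) + (+ 1 + t * + 2) ≡ + 1 + (q + t) * + 2
  regroup-odd = solve-∀
  sum≡ : u + (+ 1 + t * + 2) ≡ + 1 + (u /ℕ 2 + t) * + 2
  sum≡ = trans (cong (_+ (+ 1 + t * + 2)) u≡) (regroup-odd (u /ℕ 2) t)
  sum-odd : (u + (+ 1 + t * + 2)) %ℕ 2 ≡ 1
  sum-odd = proj₁ (%ℕ2-/ℕ2 _ 1 (u /ℕ 2 + t) (s≤s (s≤s z≤n)) sum≡)
... | inj₂ (u%2≡1 , u≡) = λ same → 0≢1 (trans (sym sum-even) (trans same u%2≡1))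
  where
  0≢1 : 0 ≢ 1
  0≢1 ()
  regroup-odd : ∀ q t → (+ 1 + q * + 2) + (+ 1 + t * + 2) ≡ + 0 + (+ 1 + q + t) * + 2
  regroup-odd = solve-∀
  sum≡ : u + (+ 1 + t * + 2) ≡ + 0 + (+ 1 + u /ℕ 2 + t) * + 2
  sum≡ = trans (cong (_+ (+ 1 + t * + 2)) u≡) (regroup-odd (u /ℕ 2) t)
  sum-even : (u + (+ 1 + t * + 2)) %ℕ 2 ≡ 0
  sum-even = proj₁ (%ℕ2-/ℕ2 _ 0 (+ 1 + u /ℕ 2 + t) (s≤s z≤n) sum≡)

T-+even : ∀ u v → Σ ℤ λ o → Odd o × T (u + v * + 2) ≡ T u + v * o
T-+even u v with even-or-odd u
... | inj₁ (_ , u≡) = + 1 , (+ 0 , refl) , subst (λ u → T (u + v * + 2) ≡ T u + v * + 1) (sym u≡) (even-case (u /ℕ 2))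
  where
  open ≡-Reasoning
  even-case : ∀ q → T (+ 0 + q * + 2 + v * + 2) ≡ T (+ 0 + q * + 2) + v * + 1
  even-case q = begin
    T (+ 0 + q * + 2 + v * + 2)   ≡⟨ cong T (regroup (+ 0) q v) ⟩
    T (+ 0 + (q + v) * + 2)       ≡⟨ T-even (q + v) ⟩
    q + v                         ≡⟨ cong₂ _+_ (T-even q) (ℤP.*-identityʳ v) ⟨
    T (+ 0 + q * + 2) + v * + 1   ∎
... | inj₂ (_ , u≡) = + 3 , (+ 1 , refl) , subst (λ u → T (u + v * + 2) ≡ T u + v * + 3) (sym u≡) (odd-case (u /ℕ 2))
  where
  open ≡-Reasoning
  spread : ∀ q v → + 2 + + 3 * (q + v) ≡ + 2 + + 3 * q + v * + 3
  spread = solve-∀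
  odd-case : ∀ q → T (+ 1 + q * + 2 + v * + 2) ≡ T (+ 1 + q * + 2) + v * + 3
  odd-case q = begin
    T (+ 1 + q * + 2 + v * + 2)   ≡⟨ cong T (regroup (+ 1) q v) ⟩
    T (+ 1 + (q + v) * + 2)       ≡⟨ T-odd (q + v) ⟩
    + 2 + + 3 * (q + v)           ≡⟨ spread q v ⟩
    + 2 + + 3 * q + v * + 3       ≡⟨ cong (_+ v * + 3) (T-odd q) ⟨
    T (+ 1 + q * + 2) + v * + 3   ∎

swap : ∀ c o → c * + 2 * o ≡ c * o * + 2
swap = solve-∀

T^-+ : ∀ i n c → Σ ℤ λ o → Odd o × T^ i (n + c * two^ i) ≡ T^ i n + c * o
T^-+ zero    n c = + 1 , (+ 0 , refl) , refl
T^-+ (suc i) n c with T^-+ i n (c * + 2)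
... | o , odd-o , shifted with T-+even (T^ i n) (c * o)
... | o′ , odd-o′ , stepped = o * o′ , odd-* odd-o odd-o′ , (begin
    T (T^ i (n + c * two^ (suc i)))   ≡⟨ cong (λ z → T (T^ i (n + z))) double ⟩
    T (T^ i (n + c * + 2 * two^ i))   ≡⟨ cong T shifted ⟩
    T (T^ i n + c * + 2 * o)          ≡⟨ cong (λ z → T (T^ i n + z)) (swap c o) ⟩
    T (T^ i n + c * o * + 2)          ≡⟨ stepped ⟩
    T (T^ i n) + c * o * o′           ≡⟨ cong (λ z → T (T^ i n) + z) (ℤP.*-assoc c o o′) ⟩
    T (T^ i n) + c * (o * o′)         ∎)
  where
  open ≡-Reasoning
  double : c * two^ (suc i) ≡ c * + 2 * two^ i
  double = trans (cong (c *_) (two^-suc i)) (sym (ℤP.*-assoc c (+ 2) (two^ i)))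

x-periodic : ∀ k i → i ℕ.< k → ∀ n m → x i (n + m * two^ k) ≡ x i n
x-periodic k i i<k n m with ℕP.m≤n⇒∃[o]m+o≡n i<k
... | j , refl with T^-+ i n (m * two^ j * + 2)
... | o , _ , shifted = begin
    x i (n + m * two^ (suc i ℕ.+ j))        ≡⟨ cong (λ z → x i (n + z)) split-power ⟩
    x i (n + m * two^ j * + 2 * two^ i)     ≡⟨ cong (_%ℕ 2) shifted ⟩
    (T^ i n + m * two^ j * + 2 * o) %ℕ 2    ≡⟨ cong (λ z → (T^ i n + z) %ℕ 2) (swap (m * two^ j) o) ⟩
    (T^ i n + m * two^ j * o * + 2) %ℕ 2    ≡⟨ parity-+even (T^ i n) (m * two^ j * o) ⟩
    x i n                                   ∎
  where
  open ≡-Reasoning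
  reassociate : ∀ m p q → m * (+ 2 * (p * q)) ≡ m * q * + 2 * p
  reassociate = solve-∀
  split-power : m * two^ (suc i ℕ.+ j) ≡ m * two^ j * + 2 * two^ i
  split-power = begin
    m * two^ (suc i ℕ.+ j)           ≡⟨ cong (m *_) (two^-suc (i ℕ.+ j)) ⟩
    m * (+ 2 * two^ (i ℕ.+ j))       ≡⟨ cong (λ z → m * (+ 2 * z)) (two^-+ i j) ⟩
    m * (+ 2 * (two^ i * two^ j))    ≡⟨ reassociate m (two^ i) (two^ j) ⟩
    m * two^ j * + 2 * two^ i        ∎

x-flip : ∀ k n → x k (n + two^ k) ≢ x k n
x-flip k n with T^-+ k n (+ 1)
... | o , odd-o , shifted = λ same → parity-+odd (T^ k n) odd-o (trans (sym shifted′) same)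
  where
  shifted′ : x k (n + two^ k) ≡ (T^ k n + o) %ℕ 2
  shifted′ = cong (_%ℕ 2) (begin
    T^ k (n + two^ k)            ≡⟨ cong (λ z → T^ k (n + z)) (ℤP.*-identityˡ (two^ k)) ⟨
    T^ k (n + + 1 * two^ k)      ≡⟨ shifted ⟩
    T^ k n + + 1 * o             ≡⟨ cong (λ z → T^ k n + z) (ℤP.*-identityˡ o) ⟩
    T^ k n + o                   ∎)
    where open ≡-Reasoning

parities⇒congruent : ∀ k a b → (∀ i → i ℕ.< k → x i a ≡ x i b) → Σ ℤ λ m → b ≡ a + m * two^ k
parities⇒congruent zero a b _ = b - a , sym (cancel a b)
  where
  cancel : ∀ a b → a + (b - a) * + 1 ≡ b
  cancel = solve-∀
parities⇒congruent (suc k) a b same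
  with parities⇒congruent k a b (λ i i<k → same i (ℕP.m≤n⇒m≤1+n i<k))
... | m , b≡ with even-or-odd m
... | inj₁ (_ , m≡) = m /ℕ 2 , (begin
    b                                  ≡⟨ b≡ ⟩
    a + m * two^ k                     ≡⟨ cong (λ z → a + z * two^ k) m≡ ⟩
    a + (+ 0 + m /ℕ 2 * + 2) * two^ k  ≡⟨ even-multiple a (m /ℕ 2) (two^ k) ⟩
    a + m /ℕ 2 * (+ 2 * two^ k)        ≡⟨ cong (λ z → a + m /ℕ 2 * z) (two^-suc k) ⟨
    a + m /ℕ 2 * two^ (suc k)          ∎)
  where
  open ≡-Reasoning
  even-multiple : ∀ a q p → a + (+ 0 + q * + 2) * p ≡ a + q * (+ 2 * p)
  even-multiple = solve-∀
... | inj₂ (_ , m≡) = ⊥-elim (x-flip k a′ (begin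
    x k (a′ + two^ k)   ≡⟨ cong (x k) b≡′ ⟨
    x k b               ≡⟨ same k ℕP.≤-refl ⟨
    x k a               ≡⟨ x-periodic (suc k) k ℕP.≤-refl a (m /ℕ 2) ⟨
    x k a′              ∎))
  where
  open ≡-Reasoning
  a′ : ℤ
  a′ = a + m /ℕ 2 * two^ (suc k)
  odd-multiple : ∀ a q p → a + (+ 1 + q * + 2) * p ≡ a + q * (+ 2 * p) + p
  odd-multiple = solve-∀
  b≡′ : b ≡ a′ + two^ k
  b≡′ = begin
    b                                      ≡⟨ b≡ ⟩
    a + m * two^ k                         ≡⟨ cong (λ z → a + z * two^ k) m≡ ⟩
    a + (+ 1 + m /ℕ 2 * + 2) * two^ k      ≡⟨ odd-multiple a (m /ℕ 2) (two^ k) ⟩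
    a + m /ℕ 2 * (+ 2 * two^ k) + two^ k   ≡⟨ cong (λ z → a + m /ℕ 2 * z + two^ k) (two^-suc k) ⟨
    a′ + two^ k                            ∎

x-digits : ∀ n → Digits (λ i → x i n)
x-digits n i = ℕP.≤-pred (n%ℕd<d (T^ i n) 2)

digit-dichotomy : ∀ {p q r} → p ℕ.≤ 1 → q ℕ.≤ 1 → r ℕ.≤ 1 → q ≢ p → r ≢ p → q ≡ r
digit-dichotomy z≤n       z≤n       _         q≢p _   = ⊥-elim (q≢p refl)
digit-dichotomy z≤n       (s≤s z≤n) z≤n       _   r≢p = ⊥-elim (r≢p refl)
digit-dichotomy z≤n       (s≤s z≤n) (s≤s z≤n) _   _   = refl
digit-dichotomy (s≤s z≤n) (s≤s z≤n) _         q≢p _   = ⊥-elim (q≢p refl)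
digit-dichotomy (s≤s z≤n) z≤n       z≤n       _   _   = refl
digit-dichotomy (s≤s z≤n) z≤n       (s≤s z≤n) _   r≢p = ⊥-elim (r≢p refl)

add-zero : ∀ n p → n + + 0 * p ≡ n
add-zero = solve-∀

-- Adding either 0 or 2^k to n makes x_k equal to any prescribed digit
-- (while x_i for i < k is unchanged by x-periodic).
prescribe : ∀ k n d → d ℕ.≤ 1 → Σ ℕ λ t → t ℕ.≤ 1 × x k (n + + t * two^ k) ≡ d
prescribe k n d d≤1 with x k n ℕ.≟ d
... | yes xₖ≡d = 0 , z≤n , trans (cong (x k) (add-zero n (two^ k))) xₖ≡d
... | no  xₖ≢d = 1 , s≤s z≤n ,
  digit-dichotomy (x-digits n k) (x-digits (n + + 1 * two^ k) k) d≤1 flipped (λ d≡ → xₖ≢d (sym d≡))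
  where
  flipped : x k (n + + 1 * two^ k) ≢ x k n
  flipped = subst (λ z → x k (n + z) ≢ x k n) (sym (ℤP.*-identityˡ (two^ k))) (x-flip k n)

pos-offset : ∀ a t k → + (a ℕ.+ t ℕ.* 2 ^ k) ≡ + a + + t * two^ k
pos-offset a t k = trans (ℤP.pos-+ a (t ℕ.* 2 ^ k)) (cong (λ z → + a + z) (ℤP.pos-* t (2 ^ k)))

realise : ∀ k d → Digits d → Σ ℕ λ a → a ℕ.< 2 ^ k × (∀ i → i ℕ.< k → x i (+ a) ≡ d i)
realise zero    d _      = 0 , s≤s z≤n , λ _ ()
realise (suc k) d digits with realise k d digits
... | a , a<2^k , realised with prescribe k (+ a) (d k) (digits k)
... | t , t≤1 , xₖ≡dₖ = a ℕ.+ t ℕ.* 2 ^ k , bound , realised′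
  where
  bound : a ℕ.+ t ℕ.* 2 ^ k ℕ.< 2 ^ suc k
  bound = begin-strict
    a ℕ.+ t ℕ.* 2 ^ k        <⟨ ℕP.+-monoˡ-< (t ℕ.* 2 ^ k) a<2^k ⟩
    2 ^ k ℕ.+ t ℕ.* 2 ^ k    ≤⟨ ℕP.+-monoʳ-≤ (2 ^ k) (ℕP.*-monoˡ-≤ (2 ^ k) t≤1) ⟩
    2 ^ k ℕ.+ 1 ℕ.* 2 ^ k    ∎
    where open ℕP.≤-Reasoning
  realised′ : ∀ i → i ℕ.< suc k → x i (+ (a ℕ.+ t ℕ.* 2 ^ k)) ≡ d i
  realised′ i i<k+1 rewrite pos-offset a t k with ℕP.m<1+n⇒m<n∨m≡n i<k+1
  ... | inj₁ i<k  = trans (x-periodic k i i<k (+ a) (+ t)) (realised i i<k)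
  ... | inj₂ refl = xₖ≡dₖ

offset-≥ : ∀ k a b n → + b ≡ + a + + suc n * two^ k → 2 ^ k ℕ.≤ b
offset-≥ k a b n b≡ = begin
  2 ^ k                        ≤⟨ ℕP.m≤m+n (2 ^ k) (n ℕ.* 2 ^ k) ⟩
  suc n ℕ.* 2 ^ k              ≤⟨ ℕP.m≤n+m (suc n ℕ.* 2 ^ k) a ⟩
  a ℕ.+ suc n ℕ.* 2 ^ k        ≡⟨ ℤP.+-injective (trans b≡ (sym (pos-offset a (suc n) k))) ⟨
  b                            ∎
  where open ℕP.≤-Reasoning

residue-unique : ∀ k a b m → a ℕ.< 2 ^ k → b ℕ.< 2 ^ k → + b ≡ + a + m * two^ k → a ≡ b
residue-unique k a b (+ 0)     _   _   b≡ = ℤP.+-injective (sym (trans b≡ (add-zero (+ a) (two^ k))))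
residue-unique k a b (+ suc n) _   b<  b≡ = ⊥-elim (ℕP.<⇒≱ b< (offset-≥ k a b n b≡))
residue-unique k a b -[1+ n ]  a<  _   b≡ = ⊥-elim (ℕP.<⇒≱ a< (offset-≥ k b a n a≡))
  where
  move : ∀ a m p → a ≡ a + m * p + (- m) * p
  move = solve-∀
  a≡ : + a ≡ + b + + suc n * two^ k
  a≡ = trans (move (+ a) -[1+ n ] (two^ k)) (cong (λ z → z + + suc n * two^ k) (sym b≡))

divides⇒offset : ∀ k u v → + (2 ^ k) ∣ (u - v) → Σ ℤ λ m → u ≡ v + m * two^ k
divides⇒offset k u v 2^k∣u-v with Signed.∣ᵤ⇒∣ 2^k∣u-v
... | Signed.divides m u-v≡ = m , trans (sym (restore v u)) (cong (λ z → v + z) u-v≡)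
  where
  restore : ∀ v u → v + (u - v) ≡ u
  restore = solve-∀

offset⇒divides : ∀ k u v m → u ≡ v + m * two^ k → + (2 ^ k) ∣ (u - v)
offset⇒divides k u v m u≡ = Signed.∣⇒∣ᵤ (Signed.divides m (trans (cong (_- v) u≡) (cancel v (m * two^ k))))
  where
  cancel : ∀ v w → v + w - v ≡ w
  cancel = solve-∀

x-T : ∀ i n → x i (T n) ≡ x (suc i) n
x-T i n = cong (_%ℕ 2) (T^-T i)
  where
  T^-T : ∀ i → T^ i (T n) ≡ T (T^ i n)
  T^-T zero    = refl
  T^-T (suc i) = cong T (T^-T i)

ShiftedParities : ℕ → ℕ → ℕ → Set
ShiftedParities k a b = ∀ i → suc i ℕ.< k → x (suc i) (+ a) ≡ x i (+ b)

CEdge⇒shifted : ∀ k a b → CEdge k a b → ShiftedParities k a b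
CEdge⇒shifted k a b (a₁ , b₁ , 2^k∣a₁-a , 2^k∣b₁-b , Ta₁≡b₁) i i+1<k
  with divides⇒offset k a₁ (+ a) 2^k∣a₁-a | divides⇒offset k b₁ (+ b) 2^k∣b₁-b
... | m , a₁≡ | m′ , b₁≡ = begin
  x (suc i) (+ a)                ≡⟨ x-periodic k (suc i) i+1<k (+ a) m ⟨
  x (suc i) (+ a + m * two^ k)   ≡⟨ cong (x (suc i)) a₁≡ ⟨
  x (suc i) a₁                   ≡⟨ x-T i a₁ ⟨
  x i (T a₁)                     ≡⟨ cong (x i) Ta₁≡b₁ ⟩
  x i b₁                         ≡⟨ cong (x i) b₁≡ ⟩
  x i (+ b + m′ * two^ k)        ≡⟨ x-periodic k i (ℕP.<-trans (ℕP.n<1+n i) i+1<k) (+ b) m′ ⟩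
  x i (+ b)                      ∎
  where open ≡-Reasoning

-- Conversely, lift a to a₁ ∈ {a, a + 2^(k+1)} with x_{k+1}(a₁) = x_k(b); then
-- T a₁ has the parities of b up to k, hence T a₁ ≡ b modulo 2^(k+1).
shifted⇒CEdge : ∀ k a b → ShiftedParities (suc k) a b → CEdge (suc k) a b
shifted⇒CEdge k a b shifted =
  a₁ , T a₁ , offset⇒divides (suc k) a₁ (+ a) (+ t) refl ,
  offset⇒divides (suc k) (T a₁) (+ b) (proj₁ congruent) (proj₂ congruent) , refl
  where
  lift : Σ ℕ λ t → t ℕ.≤ 1 × x (suc k) (+ a + + t * two^ (suc k)) ≡ x k (+ b)
  lift = prescribe (suc k) (+ a) (x k (+ b)) (x-digits (+ b) k)
  t : ℕ
  t = proj₁ lift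
  a₁ : ℤ
  a₁ = + a + + t * two^ (suc k)
  x-a₁ : ∀ i → i ℕ.< suc k → x (suc i) a₁ ≡ x i (+ b)
  x-a₁ i i<k+1 with ℕP.m<1+n⇒m<n∨m≡n i<k+1
  ... | inj₁ i<k  = trans (x-periodic (suc k) (suc i) (s≤s i<k) (+ a) (+ t)) (shifted i (s≤s i<k))
  ... | inj₂ refl = proj₂ (proj₂ lift)
  congruent : Σ ℤ λ m → T a₁ ≡ + b + m * two^ (suc k)
  congruent = parities⇒congruent (suc k) (+ b) (T a₁) (λ i i<k+1 → sym (trans (x-T i a₁) (x-a₁ i i<k+1)))

bit-Φ : ∀ k n j → j ℕ.< k → bit (Φ k n) j ≡ x j (+ n)
bit-Φ k n = bit-value k (λ i → x i (+ n)) (x-digits (+ n))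

BEdge⇒shifted : ∀ k a b → BEdge k (Φ k a) (Φ k b) → ShiftedParities k a b
BEdge⇒shifted k a b edge i i+1<k =
  trans (sym (bit-Φ k a (suc i) i+1<k)) (trans (edge i i+1<k) (bit-Φ k b i (ℕP.<-trans (ℕP.n<1+n i) i+1<k)))

shifted⇒BEdge : ∀ k a b → ShiftedParities k a b → BEdge k (Φ k a) (Φ k b)
shifted⇒BEdge k a b shifted i i+1<k =
  trans (bit-Φ k a (suc i) i+1<k) (trans (shifted i i+1<k) (sym (bit-Φ k b i (ℕP.<-trans (ℕP.n<1+n i) i+1<k))))

Φ< : ∀ k n → Φ k n ℕ.< 2 ^ k
Φ< k n = value< k (λ i → x i (+ n)) (x-digits (+ n))

-- Equal images give equal parity vectors, hence congruent and so equal residues.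
Φ-injective : ∀ k a b → a ℕ.< 2 ^ k → b ℕ.< 2 ^ k → Φ k a ≡ Φ k b → a ≡ b
Φ-injective k a b a<2^k b<2^k Φa≡Φb = residue-unique k a b (proj₁ congruent) a<2^k b<2^k (proj₂ congruent)
  where
  same : ∀ i → i ℕ.< k → x i (+ a) ≡ x i (+ b)
  same i i<k = trans (sym (bit-Φ k a i i<k)) (trans (cong (λ c → bit c i) Φa≡Φb) (bit-Φ k b i i<k))
  congruent : Σ ℤ λ m → + b ≡ + a + m * two^ k
  congruent = parities⇒congruent k (+ a) (+ b) same

-- c is the image of a residue realising the binary digits of c as parities.
Φ-surjective : ∀ k c → c ℕ.< 2 ^ k → Σ ℕ λ a → a ℕ.< 2 ^ k × Φ k a ≡ c
Φ-surjective k c c<2^k with realise k (bit c) (bit-digits c)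
... | a , a<2^k , realised = a , a<2^k , trans (value-cong k realised) (value-bit k c c<2^k)

theorem1 : (k : ℕ) → k ≥ 1 → IsGraphIso (2 ^ k) (CEdge k) (BEdge k) (Φ k)
theorem1 (suc k) _ =
  (λ a _ → Φ< (suc k) a) ,
  Φ-injective (suc k) ,
  Φ-surjective (suc k) ,
  λ a b _ _ → (λ edge → shifted⇒BEdge (suc k) a b (CEdge⇒shifted (suc k) a b edge)) ,
              (λ edge → shifted⇒CEdge k a b (BEdge⇒shifted (suc k) a b edge))
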